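{- Let $n\geq 0$. For every $v\in\{a,b\}^n$ one has $|\psi(v)|\leq F_{n+1}-2$, with equality if and only if $v=v^{(n)}$ or $v=E(v^{(n)})$.
   Context: Let $\mathcal{A}=\{a,b\}$. For $w\in\mathcal{A}^*$, $w^{(+)}$ is the shortest palindrome having $w$ as a prefix. The palindromization map $\psi$ is defined by $\psi(\varepsilon)=\varepsilon$ and $\psi(vx)=(\psi(v)x)^{(+)}$ for $v\in\mathcal{A}^*$, $x\in\mathcal{A}$. $v^{(n)}$ is the prefix of length $n$ of $(ab)^\omega$. $E$ is the automorphism of $\mathcal{A}^*$ exchanging $a$ and $b$. Fibonacci numbers: $F_{ -1}=F_0=1$, $F_{n+1}=F_n+F_{n-1}$. -}

module Defs where

open import Data.Nat using (ℕ; zero; suc; _+_; _%_; _≡ᵇ_)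
open import Data.Bool using (Bool; true; false; if_then_else_)
open import Data.List using (List; []; _∷_; _++_; reverse; take; length)
open import Data.List.Properties using (≡-dec)
open import Data.Vec using (Vec; tabulate)
open import Data.Fin using (Fin; toℕ)
open import Relation.Binary.PropositionalEquality using (_≡_; refl)
open import Relation.Nullary using (Dec; yes; no; does)

data Letter : Set where
  a b : Letter

_≟L_ : (x y : Letter) → Dec (x ≡ y)
a ≟L a = yes refl
a ≟L b = no (λ ())
b ≟L a = no (λ ())
b ≟L b = yes refl

Word : Set
Word = List Letter

isPal : Word → Bool
isPal w = does (≡-dec _≟L_ w (reverse w))

-- w^(+): the shortest palindrome having w as a prefix.
-- Any palindrome w x with |x| = k must have x = reverse (take k w); so we
-- search k = 0, 1, 2, ... for the first k making w ++ reverse (take k w)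
-- a palindrome (k = |w| always works, so the fuel |w| + 1 suffices).
plus : Word → Word
plus w = go 0 (suc (length w))
  where
  go : ℕ → ℕ → Word
  go k zero = w ++ reverse w
  go k (suc fuel) with isPal (w ++ reverse (take k w))
  ... | true  = w ++ reverse (take k w)
  ... | false = go (suc k) fuel

-- palindromization map: ψ(ε) = ε, ψ(v x) = (ψ(v) x)^(+).
-- Implemented by processing the word left to right.
psiAcc : Word → Word → Word
psiAcc acc [] = acc
psiAcc acc (x ∷ v) = psiAcc (plus (acc ++ (x ∷ []))) v

ψ : Word → Word
ψ v = psiAcc [] v

E : Letter → Letter
E a = b
E b = a

vAlt : (n : ℕ) → Vec Letter n
vAlt n = tabulate (λ i → if (toℕ i % 2) ≡ᵇ 0 then a else b)

-- Fibonacci with F_{-1} = F_0 = 1; here Fib k = F_k for k ≥ 0,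
-- so Fib 0 = 1, Fib 1 = F_0 + F_{-1} = 2, Fib (k+2) = Fib (k+1) + Fib k.
Fib : ℕ → ℕ
Fib zero = 1
Fib (suc zero) = 2
Fib (suc (suc k)) = Fib (suc k) + Fib k

{-# OPTIONS --safe #-}

-- If x occurs in v, say v = w x u, then ψ(v) begins with
-- ψ(w) x and, being a palindrome, ψ(v) x ends with the palindrome x ψ(w) x; hence
-- |ψ(v x)| ≤ 2|ψ v| − |ψ w|. Conversely the longest palindromic suffix of ψ(v) x either has
-- length ≤ 1 or is x ψ(v₁) x for an occurrence v = v₁ x v₂, so |ψ(v x)| ≥ 2|ψ v| − |ψ v₁|.
-- Induction along the last run of v turns the upper bound into
-- |ψ(v y x)| ≤ |ψ(v y)| + |ψ v| + 2, strictly if x = y, so |ψ v| ≤ B_|v| where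
-- B_{n+2} = B_{n+1} + B_n + 2, i.e. B_n = F_{n+1} − 2, and equality forces every two adjacent
-- letters to differ. For an alternating word w x y x the last x of w x y comes right after w,
-- so the lower bound gives |ψ(w x y x)| ≥ 2 B_{n+2} − B_n = B_{n+3}.

module Submission where

open import Defs
open import Data.Nat using (ℕ; suc; _≤_; _∸_)
open import Data.List using (length)
open import Data.Vec using (Vec; toList; map)
open import Data.Sum using (_⊎_)
open import Data.Product using (_×_)
open import Function.Bundles using (_⇔_)
open import Relation.Binary.PropositionalEquality using (_≡_)

open import Data.Nat using (zero; _+_; _<_; _%_; _≡ᵇ_; z≤n; s≤s)
open import Data.Nat.Properties
open import Data.Nat.Induction using (<-wellFounded)
open import Data.Nat.DivMod using ([m+n]%n≡m%n)
open import Data.Nat.Tactic.RingSolver using (solve-∀)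
open import Data.Bool using (Bool; true; false; if_then_else_)
open import Data.Empty using (⊥-elim)
open import Data.Fin using (toℕ)
open import Data.List using (List; []; _∷_; _++_; _∷ʳ_; [_]; reverse; take; drop)
open import Data.List.Properties
  using (length-++; length-reverse; reverse-++; reverse-involutive; unfold-reverse; take++drop≡id; length-take;
         ++-assoc; ++-identityʳ; ∷-injective; ∷ʳ-injective; ∷ʳ-++; length-++-sucʳ; length-++-≤ˡ; ≡-dec)
open import Data.List.Reverse using (Reverse; []; _∶_∶ʳ_; reverseView)
open import Data.List.Relation.Unary.Linked using (Linked; []; [-]; _∷_)
open import Data.List.Relation.Unary.Any using (here)
open import Data.List.Membership.Propositional using (_∉_)
open import Data.List.Membership.Propositional.Properties using (∈-++⁺ʳ)
open import Data.Product using (∃; ∃₂; _,_; proj₁; proj₂)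
open import Data.Sum using (inj₁; inj₂)
open import Data.Vec using ([]; _∷_; tabulate)
open import Data.Vec.Properties using (length-toList; tabulate-cong)
open import Function.Bundles using (mk⇔; Equivalence)
open import Induction.WellFounded using (module All)
import Relation.Binary.Construct.On as On
open import Relation.Binary.PropositionalEquality
  using (refl; sym; trans; cong; cong₂; subst; subst₂; _≢_; module ≡-Reasoning)
open import Relation.Nullary using (yes; no)

Pal : Word → Set
Pal w = w ≡ reverse w

isPal-sound : ∀ w → isPal w ≡ true → Pal w
isPal-sound w _ with ≡-dec _≟L_ w (reverse w)
isPal-sound w _  | yes pal = pal
isPal-sound w () | no _

isPal-complete : ∀ w → Pal w → isPal w ≡ true
isPal-complete w pal with ≡-dec _≟L_ w (reverse w)
... | yes _   = refl
... | no ¬pal = ⊥-elim (¬pal pal)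

Pal-wrap : ∀ t {s} → Pal s → Pal (t ++ s ++ reverse t)
Pal-wrap t {s} pal = sym (begin
  reverse (t ++ s ++ reverse t)                ≡⟨ reverse-++ t (s ++ reverse t) ⟩
  reverse (s ++ reverse t) ++ reverse t        ≡⟨ cong (_++ reverse t) (reverse-++ s (reverse t)) ⟩
  (reverse (reverse t) ++ reverse s) ++ reverse t
    ≡⟨ cong₂ (λ u v → (u ++ v) ++ reverse t) (reverse-involutive t) (sym pal) ⟩
  (t ++ s) ++ reverse t                        ≡⟨ ++-assoc t s (reverse t) ⟩
  t ++ s ++ reverse t                          ∎)
  where open ≡-Reasoning

Pal-unwrap : ∀ z m z′ → Pal (z ∷ m ∷ʳ z′) → z ≡ z′ × Pal m
Pal-unwrap z m z′ pal = proj₁ ends , proj₁ (∷ʳ-injective m (reverse m) (proj₂ ends))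
  where
  ends : z ≡ z′ × m ∷ʳ z′ ≡ reverse m ∷ʳ z
  ends = ∷-injective (trans pal (trans (unfold-reverse z (m ∷ʳ z′)) (cong (_∷ʳ z) (reverse-++ m [ z′ ]))))

Pal-mirror : ∀ {w} t x m → Pal w → w ≡ t ++ x ∷ m → w ≡ reverse m ++ x ∷ reverse t
Pal-mirror {w} t x m palw refl = begin
  w                              ≡⟨ palw ⟩
  reverse (t ++ x ∷ m)           ≡⟨ reverse-++ t (x ∷ m) ⟩
  reverse (x ∷ m) ++ reverse t   ≡⟨ cong (_++ reverse t) (unfold-reverse x m) ⟩
  (reverse m ∷ʳ x) ++ reverse t  ≡⟨ ∷ʳ-++ (reverse m) x (reverse t) ⟩
  reverse m ++ x ∷ reverse t     ∎
  where open ≡-Reasoning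

Pal-∷ʳ-mirror : ∀ {w p} x r → Pal w → Pal p → w ≡ p ++ x ∷ r → w ∷ʳ x ≡ reverse r ++ (x ∷ p ∷ʳ x)
Pal-∷ʳ-mirror {w} {p} x r palw palp split = begin
  w ∷ʳ x                              ≡⟨ cong (_∷ʳ x) (Pal-mirror p x r palw split) ⟩
  (reverse r ++ x ∷ reverse p) ∷ʳ x   ≡⟨ cong (λ m → (reverse r ++ x ∷ m) ∷ʳ x) (sym palp) ⟩
  (reverse r ++ x ∷ p) ∷ʳ x           ≡⟨ ++-assoc (reverse r) (x ∷ p) [ x ] ⟩
  reverse r ++ (x ∷ p ∷ʳ x)           ∎
  where open ≡-Reasoning

length-∷ʳ : ∀ (w : Word) x → length (w ∷ʳ x) ≡ suc (length w)
length-∷ʳ w x = trans (length-++ w) (+-comm (length w) 1)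

length-<-++-∷ : ∀ (w : Word) x u → length w < length (w ++ x ∷ u)
length-<-++-∷ w x u = ≤-trans (s≤s (length-++-≤ˡ w)) (≤-reflexive (sym (length-++-sucʳ w x u)))

++-injective-length : ∀ (xs zs : Word) {ys ws} → length xs ≡ length zs → xs ++ ys ≡ zs ++ ws → xs ≡ zs × ys ≡ ws
++-injective-length []       []       _   e = refl , e
++-injective-length (x ∷ xs) (z ∷ zs) len e with ∷-injective e
... | x≡z , e′ with ++-injective-length xs zs (suc-injective len) e′
... | xs≡zs , ys≡ws = cong₂ _∷_ x≡z xs≡zs , ys≡ws

infix 4 _⊑_

_⊑_ : Word → Word → Set
s ⊑ t = ∃ λ r → s ++ r ≡ t

⊑-refl : ∀ {s} → s ⊑ s
⊑-refl {s} = [] , ++-identityʳ s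

⊑-trans : ∀ {s t u} → s ⊑ t → t ⊑ u → s ⊑ u
⊑-trans {s} (r , refl) (r′ , refl) = r ++ r′ , sym (++-assoc s r r′)

⊑-length : ∀ {s t} → s ⊑ t → length s ≤ length t
⊑-length {s} (r , refl) = length-++-≤ˡ s

⊑-of-shorter : ∀ {s₁ s₂ t} → s₁ ⊑ t → s₂ ⊑ t → length s₁ ≤ length s₂ → s₁ ⊑ s₂
⊑-of-shorter {[]}     {s₂}     _           _         _        = s₂ , refl
⊑-of-shorter {x ∷ s₁} {y ∷ s₂} (r₁ , refl) (r₂ , e₂) (s≤s le) with ∷-injective e₂
... | refl , e₂′ with ⊑-of-shorter (r₁ , refl) (r₂ , e₂′) le
... | r , e = r , cong (x ∷_) e

⊑-of-longer : ∀ {s t} → s ⊑ t → length t ≤ length s → s ≡ t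
⊑-of-longer {s} ([]    , refl) _  = sym (++-identityʳ s)
⊑-of-longer {s} (x ∷ r , refl) le = ⊥-elim (<⇒≱ (length-<-++-∷ s x r) le)

⊑-same-length : ∀ {s₁ s₂ t} → s₁ ⊑ t → s₂ ⊑ t → length s₁ ≡ length s₂ → s₁ ≡ s₂
⊑-same-length p₁ p₂ e = ⊑-of-longer (⊑-of-shorter p₁ p₂ (≤-reflexive e)) (≤-reflexive (sym e))

-- `plus` searches k = 0, 1, … through a local loop of Defs that cannot be named
-- from here; this meta is solved by unification with (the `with`-function of) that loop.
mutual
  plusSearch : Word → ℕ → ℕ → Bool → Word
  plusSearch = _

  plus≡plusSearch : ∀ w → plus w ≡ plusSearch w 0 (length w) (isPal (w ++ []))
  plus≡plusSearch w with length w
  ... | n with isPal (w ++ [])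
  ... | found with 0
  ... | k = refl

PalCompletion : Word → Word → Set
PalCompletion w q = ∃ λ r → q ≡ w ++ r × Pal (w ++ r) × length r ≤ length w

length-take-≤ : ∀ k (w : Word) → length (take k w) ≤ length w
length-take-≤ k w = ≤-trans (≤-reflexive (length-take k w)) (m⊓n≤n k (length w))

plusSearch-completion : ∀ w k n found → found ≡ isPal (w ++ reverse (take k w)) →
  PalCompletion w (plusSearch w k n found)
plusSearch-completion w k n       true  e = reverse (take k w) , refl , isPal-sound _ (sym e) ,
  ≤-trans (≤-reflexive (length-reverse (take k w))) (length-take-≤ k w)
plusSearch-completion w k zero    false _ = reverse w , refl , Pal-wrap w refl , ≤-reflexive (length-reverse w)
plusSearch-completion w k (suc n) false _ = plusSearch-completion w (suc k) n _ refl

plus-completion : ∀ w → PalCompletion w (plus w)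
plus-completion w with plusSearch-completion w 0 (length w) _ refl
... | r , e , pal , short = r , trans (plus≡plusSearch w) e , pal , short

plus-⊒ : ∀ w → w ⊑ plus w
plus-⊒ w with plus-completion w
... | r , e , _ , _ = r , sym e

plus-pal : ∀ w → Pal (plus w)
plus-pal w with plus-completion w
... | r , e , pal , _ = subst Pal (sym e) pal

plusSearch-minimal : ∀ w j k n found → found ≡ isPal (w ++ reverse (take k w)) → k ≤ j → j ≤ k + n →
  isPal (w ++ reverse (take j w)) ≡ true → length (plusSearch w k n found) ≤ length w + j
plusSearch-minimal w j k n true _ k≤j _ _ = begin
  length (w ++ reverse (take k w))       ≡⟨ length-++ w ⟩
  length w + length (reverse (take k w)) ≡⟨ cong (length w +_) (length-reverse (take k w)) ⟩
  length w + length (take k w)           ≤⟨ +-monoʳ-≤ (length w) (≤-trans (≤-reflexive (length-take k w)) (m⊓n≤m k _)) ⟩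
  length w + k                           ≤⟨ +-monoʳ-≤ (length w) k≤j ⟩
  length w + j                           ∎
  where open ≤-Reasoning
plusSearch-minimal w j k zero false e k≤j j≤k+0 _ with ≤-antisym k≤j (≤-trans j≤k+0 (≤-reflexive (+-identityʳ k)))
plusSearch-minimal w j j zero false e _ _ found-j | refl with trans e found-j
... | ()
plusSearch-minimal w j k (suc n) false e k≤j j≤k+n found-j with k ≟ j
... | yes refl with trans e found-j
...   | ()
plusSearch-minimal w j k (suc n) false e k≤j j≤k+n found-j | no k≢j =
  plusSearch-minimal w j (suc k) n _ refl (≤∧≢⇒< k≤j k≢j) (≤-trans j≤k+n (≤-reflexive (+-suc k n))) found-j

plus-minimal : ∀ u {q} → Pal q → u ⊑ q → length (plus u) ≤ length q
plus-minimal u {q} pal (t , refl) with length u ≤? length t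
... | yes u≤t with plus-completion u
...   | r , e , _ , r≤u = begin
  length (plus u)     ≡⟨ cong length e ⟩
  length (u ++ r)     ≡⟨ length-++ u ⟩
  length u + length r ≤⟨ +-monoʳ-≤ (length u) (≤-trans r≤u u≤t) ⟩
  length u + length t ≡⟨ sym (length-++ u) ⟩
  length (u ++ t)     ∎
  where open ≤-Reasoning
plus-minimal u {q} pal (t , refl) | no u≰t = begin
  length (plus u)                                 ≡⟨ cong length (plus≡plusSearch u) ⟩
  length (plusSearch u 0 (length u) (isPal (u ++ []))) ≤⟨ plusSearch-minimal u k 0 (length u) _ refl z≤n k≤u found ⟩
  length u + k                                    ≡⟨ sym (length-++ u) ⟩
  length (u ++ t)                                 ∎
  where
  open ≤-Reasoning
  k : ℕ
  k = length t
  k≤u : k ≤ length u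
  k≤u = <⇒≤ (≰⇒> u≰t)
  take≡reverse : take k u ≡ reverse t
  take≡reverse = proj₁ (++-injective-length (take k u) (reverse t)
    (trans (trans (length-take k u) (m≤n⇒m⊓n≡m k≤u)) (sym (length-reverse t)))
    (trans (sym (++-assoc (take k u) (drop k u) t))
      (trans (cong (_++ t) (take++drop≡id k u)) (trans pal (reverse-++ u t)))))
  found : isPal (u ++ reverse (take k u)) ≡ true
  found = isPal-complete _ (subst (λ z → Pal (u ++ z))
    (trans (sym (reverse-involutive t)) (cong reverse (sym take≡reverse))) pal)

plus-≤-palSuffix : ∀ {u} t {s} → u ≡ t ++ s → Pal s → length (plus u) ≤ length u + length t
plus-≤-palSuffix {u} t {s} refl pal = begin
  length (plus u)               ≤⟨ plus-minimal u (subst Pal (sym (++-assoc t s (reverse t))) (Pal-wrap t pal))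
                                                  (reverse t , refl) ⟩
  length (u ++ reverse t)       ≡⟨ length-++ u ⟩
  length u + length (reverse t) ≡⟨ cong (length u +_) (length-reverse t) ⟩
  length u + length t           ∎
  where open ≤-Reasoning

plus-palSuffix : ∀ u → ∃₂ λ t s → u ≡ t ++ s × Pal s × length (plus u) + length s ≡ length u + length u
plus-palSuffix u with plus-completion u
... | r , e , pal , r≤u = t , s , sym (take++drop≡id k u) , s-pal , lengths
  where
  k : ℕ
  k = length r
  t s : Word
  t = take k u
  s = drop k u
  length-t : length t ≡ k
  length-t = trans (length-take k u) (m≤n⇒m⊓n≡m r≤u)
  -- u ++ r = reverse r ++ reverse u, cut after k letters
  halves : t ≡ reverse r × s ++ r ≡ reverse u
  halves = ++-injective-length t (reverse r) (trans length-t (sym (length-reverse r)))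
    (trans (sym (++-assoc t s r)) (trans (cong (_++ r) (take++drop≡id k u)) (trans pal (reverse-++ u r))))
  s-pal : Pal s
  s-pal = proj₁ (++-injective-length s (reverse s) (sym (length-reverse s))
    (trans (proj₂ halves) (trans (cong reverse (sym (take++drop≡id k u))) (reverse-++ t s))))
  lengths : length (plus u) + length s ≡ length u + length u
  lengths = begin
    length (plus u) + length s       ≡⟨ cong (λ z → length z + length s) e ⟩
    length (u ++ r) + length s       ≡⟨ cong (_+ length s) (length-++ u) ⟩
    length u + k + length s          ≡⟨ +-assoc (length u) k (length s) ⟩
    length u + (k + length s)        ≡⟨ cong (λ z → length u + (z + length s)) (sym length-t) ⟩
    length u + (length t + length s) ≡⟨ cong (length u +_) (trans (sym (length-++ t)) (cong length (take++drop≡id k u))) ⟩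
    length u + length u              ∎
    where open ≡-Reasoning

psiAcc-∷ʳ : ∀ acc v x → psiAcc acc (v ∷ʳ x) ≡ plus (psiAcc acc v ∷ʳ x)
psiAcc-∷ʳ acc []      x = refl
psiAcc-∷ʳ acc (y ∷ v) x = psiAcc-∷ʳ (plus (acc ∷ʳ y)) v x

ψ-∷ʳ : ∀ v x → ψ (v ∷ʳ x) ≡ plus (ψ v ∷ʳ x)
ψ-∷ʳ = psiAcc-∷ʳ []

ψ-pal : ∀ v → Pal (ψ v)
ψ-pal v with reverseView v
... | []         = refl
... | w ∶ _ ∶ʳ x = subst Pal (sym (ψ-∷ʳ w x)) (plus-pal (ψ w ∷ʳ x))

ψ-∷ʳ-⊒ : ∀ v x → ψ v ∷ʳ x ⊑ ψ (v ∷ʳ x)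
ψ-∷ʳ-⊒ v x = subst (ψ v ∷ʳ x ⊑_) (sym (ψ-∷ʳ v x)) (plus-⊒ (ψ v ∷ʳ x))

ψ-⊑ : ∀ v u → ψ v ⊑ ψ (v ++ u)
ψ-⊑ v []      = [] , trans (++-identityʳ (ψ v)) (cong ψ (sym (++-identityʳ v)))
ψ-⊑ v (x ∷ u) = ⊑-trans ([ x ] , refl) (⊑-trans (ψ-∷ʳ-⊒ v x)
  (subst (λ w → ψ (v ∷ʳ x) ⊑ ψ w) (∷ʳ-++ v x u) (ψ-⊑ (v ∷ʳ x) u)))

ψ-palPrefix : ∀ {v} → Reverse v → ∀ {s} → Pal s → s ⊑ ψ v → ∃₂ λ v₁ v₂ → v ≡ v₁ ++ v₂ × s ≡ ψ v₁
ψ-palPrefix [] _ s⊑ = [] , [] , refl , ⊑-of-longer s⊑ z≤n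
ψ-palPrefix (v ∶ rv ∶ʳ x) {s} pal s⊑ with length s ≤? length (ψ v)
... | yes short with ψ-palPrefix rv pal (⊑-of-shorter s⊑ (ψ-⊑ v [ x ]) short)
...   | v₁ , v₂ , refl , s≡ = v₁ , v₂ ∷ʳ x , ++-assoc v₁ v₂ [ x ] , s≡
ψ-palPrefix (v ∶ rv ∶ʳ x) {s} pal s⊑ | no long =
  v ∷ʳ x , [] , sym (++-identityʳ _) , ⊑-of-longer s⊑ ψ[vx]≤s
  where
  ψ[vx]≤s : length (ψ (v ∷ʳ x)) ≤ length s
  ψ[vx]≤s = subst (λ w → length w ≤ length s) (sym (ψ-∷ʳ v x))
    (plus-minimal (ψ v ∷ʳ x) pal (⊑-of-shorter (ψ-∷ʳ-⊒ v x) s⊑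
      (≤-trans (≤-reflexive (length-∷ʳ (ψ v) x)) (≰⇒> long))))

ψ-palPrefix-next : ∀ v {m} x r → Pal m → ψ v ≡ m ++ x ∷ r →
  ∃₂ λ v₁ v₂ → v ≡ v₁ ++ x ∷ v₂ × m ≡ ψ v₁
ψ-palPrefix-next v x r m-pal split with ψ-palPrefix (reverseView v) m-pal (x ∷ r , sym split)
... | v₁ , [] , refl , refl =
  ⊥-elim (<-irrefl (cong (λ w → length (ψ w)) (sym (++-identityʳ v₁)))
    (subst (λ w → length (ψ v₁) < length w) (sym split) (length-<-++-∷ (ψ v₁) x r)))
... | v₁ , z ∷ v₂ , refl , refl = v₁ , v₂ , cong (λ y → v₁ ++ y ∷ v₂) z≡x , refl
  where
  via-z : ψ v₁ ∷ʳ z ⊑ ψ (v₁ ++ z ∷ v₂)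
  via-z = ⊑-trans (ψ-∷ʳ-⊒ v₁ z) (subst (λ w → ψ (v₁ ∷ʳ z) ⊑ ψ w) (∷ʳ-++ v₁ z v₂) (ψ-⊑ (v₁ ∷ʳ z) v₂))
  via-x : ψ v₁ ∷ʳ x ⊑ ψ (v₁ ++ z ∷ v₂)
  via-x = r , trans (∷ʳ-++ (ψ v₁) x r) (sym split)
  z≡x : z ≡ x
  z≡x = proj₂ (∷ʳ-injective (ψ v₁) (ψ v₁)
    (⊑-same-length via-z via-x (trans (length-∷ʳ (ψ v₁) z) (sym (length-∷ʳ (ψ v₁) x)))))

∣ψ∣ : Word → ℕ
∣ψ∣ v = length (ψ v)

∣ψ∣-∷ʳ : ∀ v x → ∣ψ∣ (v ∷ʳ x) ≡ length (plus (ψ v ∷ʳ x))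
∣ψ∣-∷ʳ v x = cong length (ψ-∷ʳ v x)

∣ψ∣-∷ʳ-≤ : ∀ v x → ∣ψ∣ (v ∷ʳ x) ≤ suc (∣ψ∣ v + ∣ψ∣ v)
∣ψ∣-∷ʳ-≤ v x = begin
  ∣ψ∣ (v ∷ʳ x)                  ≡⟨ ∣ψ∣-∷ʳ v x ⟩
  length (plus (ψ v ∷ʳ x))      ≤⟨ plus-≤-palSuffix (ψ v) {[ x ]} refl refl ⟩
  length (ψ v ∷ʳ x) + ∣ψ∣ v     ≡⟨ cong (_+ ∣ψ∣ v) (length-∷ʳ (ψ v) x) ⟩
  suc (∣ψ∣ v + ∣ψ∣ v)           ∎
  where open ≤-Reasoning

∣ψ∣-∷ʳ-repeat-≤ : ∀ w x {v} → w ∷ʳ x ⊑ v → ∣ψ∣ (v ∷ʳ x) + ∣ψ∣ w ≤ ∣ψ∣ v + ∣ψ∣ v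
∣ψ∣-∷ʳ-repeat-≤ w x {v} (u , refl) with ⊑-trans (ψ-∷ʳ-⊒ w x) (ψ-⊑ (w ∷ʳ x) u)
... | r , split = begin
  ∣ψ∣ (v ∷ʳ x) + ∣ψ∣ w             ≤⟨ +-monoˡ-≤ (∣ψ∣ w) bound ⟩
  suc (∣ψ∣ v + length r) + ∣ψ∣ w   ≡⟨ shuffle (∣ψ∣ v) (length r) (∣ψ∣ w) ⟩
  ∣ψ∣ v + (suc (∣ψ∣ w) + length r) ≡⟨ cong (∣ψ∣ v +_) (sym length-ψv) ⟩
  ∣ψ∣ v + ∣ψ∣ v                    ∎
  where
  open ≤-Reasoning
  shuffle : ∀ a b c → suc (a + b) + c ≡ a + (suc c + b)
  shuffle = solve-∀
  length-ψv : ∣ψ∣ v ≡ suc (∣ψ∣ w) + length r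
  length-ψv = trans (cong length (sym split)) (trans (length-++ (ψ w ∷ʳ x)) (cong (_+ length r) (length-∷ʳ (ψ w) x)))
  bound : ∣ψ∣ (v ∷ʳ x) ≤ suc (∣ψ∣ v + length r)
  bound = begin
    ∣ψ∣ (v ∷ʳ x)                           ≡⟨ ∣ψ∣-∷ʳ v x ⟩
    length (plus (ψ v ∷ʳ x))               ≤⟨ plus-≤-palSuffix (reverse r)
                                                (Pal-∷ʳ-mirror x r (ψ-pal v) (ψ-pal w) (trans (sym split) (∷ʳ-++ (ψ w) x r)))
                                                (Pal-wrap [ x ] (ψ-pal w)) ⟩
    length (ψ v ∷ʳ x) + length (reverse r) ≡⟨ cong₂ _+_ (length-∷ʳ (ψ v) x) (length-reverse r) ⟩
    suc (∣ψ∣ v + length r)                 ∎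

≤-of-+≤1 : ∀ {L S P} → S ≤ 1 → L + S ≡ suc P + suc P → P + P ≤ L
≤-of-+≤1 {L} {S} {P} S≤1 e = ≤-trans (n≤1+n (P + P)) (+-cancelʳ-≤ 1 (suc (P + P)) L (begin
  suc (P + P) + 1   ≡⟨ +-comm (suc (P + P)) 1 ⟩
  suc (suc (P + P)) ≡⟨ cong suc (sym (+-suc P P)) ⟩
  suc P + suc P     ≡⟨ sym e ⟩
  L + S             ≤⟨ +-monoʳ-≤ L S≤1 ⟩
  L + 1             ∎))
  where open ≤-Reasoning

+-suc-suc-cancel : ∀ {L Q P} → L + suc (suc Q) ≡ suc P + suc P → L + Q ≡ P + P
+-suc-suc-cancel {L} {Q} {P} e = suc-injective (suc-injective (begin
  suc (suc (L + Q)) ≡⟨ cong suc (sym (+-suc L Q)) ⟩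
  suc (L + suc Q)   ≡⟨ sym (+-suc L (suc Q)) ⟩
  L + suc (suc Q)   ≡⟨ e ⟩
  suc (P + suc P)   ≡⟨ cong suc (+-suc P P) ⟩
  suc (suc (P + P)) ∎))
  where open ≡-Reasoning

SnocLowerBound : Word → Letter → Set
SnocLowerBound v x = ∣ψ∣ v + ∣ψ∣ v ≤ ∣ψ∣ (v ∷ʳ x)
  ⊎ ∃₂ λ v₁ v₂ → v ≡ v₁ ++ x ∷ v₂ × ∣ψ∣ (v ∷ʳ x) + ∣ψ∣ v₁ ≡ ∣ψ∣ v + ∣ψ∣ v

lower-from-palSuffix : ∀ v x t s → ψ v ∷ʳ x ≡ t ++ s → Pal s →
  ∣ψ∣ (v ∷ʳ x) + length s ≡ suc (∣ψ∣ v) + suc (∣ψ∣ v) → SnocLowerBound v x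
lower-from-palSuffix v x t []      _ _ lengths = inj₁ (≤-of-+≤1 z≤n lengths)
lower-from-palSuffix v x t (z ∷ s) split s-pal lengths with reverseView s
... | [] = inj₁ (≤-of-+≤1 ≤-refl lengths)
... | m ∶ _ ∶ʳ z′ with ∷ʳ-injective (ψ v) (t ++ z ∷ m) (trans split (sym (++-assoc t (z ∷ m) [ z′ ])))
                     | Pal-unwrap z m z′ s-pal
...   | ψv≡ , refl | refl , m-pal with ψ-palPrefix-next v x (reverse t) m-pal
                                      (trans (Pal-mirror t x m (ψ-pal v) ψv≡) (cong (_++ x ∷ reverse t) (sym m-pal)))
...     | v₁ , v₂ , v≡ , refl = inj₂ (v₁ , v₂ , v≡ , +-suc-suc-cancel
    (trans (cong (λ n → ∣ψ∣ (v ∷ʳ x) + suc n) (sym (length-∷ʳ (ψ v₁) z′))) lengths))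

∣ψ∣-∷ʳ-lower : ∀ v x → SnocLowerBound v x
∣ψ∣-∷ʳ-lower v x with plus-palSuffix (ψ v ∷ʳ x)
... | t , s , split , s-pal , lengths = lower-from-palSuffix v x t s split s-pal (begin
  ∣ψ∣ (v ∷ʳ x) + length s                  ≡⟨ cong (_+ length s) (∣ψ∣-∷ʳ v x) ⟩
  length (plus (ψ v ∷ʳ x)) + length s      ≡⟨ lengths ⟩
  length (ψ v ∷ʳ x) + length (ψ v ∷ʳ x)    ≡⟨ cong (λ n → n + n) (length-∷ʳ (ψ v) x) ⟩
  suc (∣ψ∣ v) + suc (∣ψ∣ v)                ∎)
  where open ≡-Reasoning

occurrence-⊑ : ∀ w {x u v₁ v₂} → x ∉ u → w ++ x ∷ u ≡ v₁ ++ x ∷ v₂ → v₁ ⊑ w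
occurrence-⊑ []      {v₁ = []}     _   _ = [] , refl
occurrence-⊑ []      {v₁ = _ ∷ v₁} x∉u e with ∷-injective e
... | _ , refl = ⊥-elim (x∉u (∈-++⁺ʳ v₁ (here refl)))
occurrence-⊑ (z ∷ w) {v₁ = []}     _   _ = z ∷ w , refl
occurrence-⊑ (z ∷ w) {v₁ = _ ∷ v₁} x∉u e with ∷-injective e
... | refl , e′ with occurrence-⊑ w x∉u e′
... | r , refl = r , refl

∣ψ∣-∷ʳ-≥ : ∀ {v} w {x u} → v ≡ w ++ x ∷ u → x ∉ u → ∣ψ∣ v + ∣ψ∣ v ≤ ∣ψ∣ (v ∷ʳ x) + ∣ψ∣ w
∣ψ∣-∷ʳ-≥ {v} w {x} v≡ x∉u with ∣ψ∣-∷ʳ-lower v x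
... | inj₁ doubled = ≤-trans doubled (m≤m+n _ _)
... | inj₂ (v₁ , v₂ , v≡′ , e) with occurrence-⊑ w x∉u (trans (sym v≡) v≡′)
...   | r , refl = begin
  ∣ψ∣ v + ∣ψ∣ v                ≡⟨ sym e ⟩
  ∣ψ∣ (v ∷ʳ x) + ∣ψ∣ v₁        ≤⟨ +-monoʳ-≤ (∣ψ∣ (v ∷ʳ x)) (⊑-length (ψ-⊑ v₁ r)) ⟩
  ∣ψ∣ (v ∷ʳ x) + ∣ψ∣ (v₁ ++ r) ∎
  where open ≤-Reasoning

≤-of-double : ∀ {α β c d} → α + c ≤ β + β → β ≤ c + d → α ≤ β + d
≤-of-double {α} {β} {c} {d} α+c≤2β β≤c+d = +-cancelʳ-≤ c α (β + d) (begin
  α + c       ≤⟨ α+c≤2β ⟩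
  β + β       ≤⟨ +-monoʳ-≤ β β≤c+d ⟩
  β + (c + d) ≡⟨ cong (β +_) (+-comm c d) ⟩
  β + (d + c) ≡⟨ sym (+-assoc β d c) ⟩
  β + d + c   ∎)
  where open ≤-Reasoning

snocRun : Word → Letter → ℕ → Word
snocRun w y zero    = w
snocRun w y (suc t) = snocRun w y t ∷ʳ y

snocRun-⊒ : ∀ w y t → w ⊑ snocRun w y t
snocRun-⊒ w y zero    = ⊑-refl
snocRun-⊒ w y (suc t) = ⊑-trans (snocRun-⊒ w y t) ([ y ] , refl)

∣ψ∣-run-increment : ∀ w y d → ∣ψ∣ (w ∷ʳ y) ≤ ∣ψ∣ w + d →
  ∀ t → ∣ψ∣ (snocRun w y (suc t)) ≤ ∣ψ∣ (snocRun w y t) + d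
∣ψ∣-run-increment w y d first zero    = first
∣ψ∣-run-increment w y d first (suc t) =
  ≤-of-double (∣ψ∣-∷ʳ-repeat-≤ (snocRun w y t) y ⊑-refl) (∣ψ∣-run-increment w y d first t)

≢⇒≡E : ∀ {x y} → x ≢ y → y ≡ E x
≢⇒≡E {a} {a} x≢y = ⊥-elim (x≢y refl)
≢⇒≡E {a} {b} _   = refl
≢⇒≡E {b} {a} _   = refl
≢⇒≡E {b} {b} x≢y = ⊥-elim (x≢y refl)

≢-cover : ∀ {x y} → x ≢ y → ∀ z → z ≡ x ⊎ z ≡ y
≢-cover {x} x≢y z with ≢⇒≡E x≢y
≢-cover {a} _ a | refl = inj₁ refl
≢-cover {a} _ b | refl = inj₂ refl
≢-cover {b} _ a | refl = inj₂ refl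
≢-cover {b} _ b | refl = inj₁ refl

last-run : ∀ {x y} → x ≢ y → ∀ {v} → Reverse v →
  (∃ λ t → v ≡ snocRun [] x t) ⊎ (∃₂ λ w t → v ≡ snocRun (w ∷ʳ y) x t)
last-run x≢y []            = inj₁ (0 , refl)
last-run x≢y (v ∶ rv ∶ʳ z) with ≢-cover x≢y z | last-run x≢y rv
... | inj₂ refl | _                  = inj₂ (v , 0 , refl)
... | inj₁ refl | inj₁ (t , refl)     = inj₁ (suc t , refl)
... | inj₁ refl | inj₂ (w , t , refl) = inj₂ (w , suc t , refl)

∣ψ∣-∷ʳ-∷ʳ-< : ∀ v y → ∣ψ∣ (v ∷ʳ y ∷ʳ y) < ∣ψ∣ (v ∷ʳ y) + (2 + ∣ψ∣ v)
∣ψ∣-∷ʳ-∷ʳ-< v y = ≤-trans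
  (s≤s (≤-of-double (∣ψ∣-∷ʳ-repeat-≤ v y ⊑-refl)
    (≤-trans (∣ψ∣-∷ʳ-≤ v y) (≤-reflexive (sym (+-suc (∣ψ∣ v) (∣ψ∣ v)))))))
  (≤-reflexive (sym (+-suc (∣ψ∣ (v ∷ʳ y)) (suc (∣ψ∣ v)))))

∣ψ∣-∷ʳ-∷ʳ-≤ : ∀ v y x → ∣ψ∣ (v ∷ʳ y ∷ʳ x) ≤ ∣ψ∣ (v ∷ʳ y) + (2 + ∣ψ∣ v)
∣ψ∣-∷ʳ-∷ʳ-≤ = All.wfRec (On.wellFounded length <-wellFounded) _ Bound step
  where
  Bound : Word → Set
  Bound v = ∀ y x → ∣ψ∣ (v ∷ʳ y ∷ʳ x) ≤ ∣ψ∣ (v ∷ʳ y) + (2 + ∣ψ∣ v)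
  step : ∀ v → (∀ {w} → length w < length v → Bound w) → Bound v
  step v rec y x with x ≟L y
  ... | yes refl = <⇒≤ (∣ψ∣-∷ʳ-∷ʳ-< v x)
  ... | no x≢y with last-run (λ y≡x → x≢y (sym y≡x)) (reverseView v)
  ...   | inj₁ (t , refl) = begin
    ∣ψ∣ (v ∷ʳ y ∷ʳ x)                  ≤⟨ ∣ψ∣-∷ʳ-≤ (v ∷ʳ y) x ⟩
    suc (∣ψ∣ (v ∷ʳ y) + ∣ψ∣ (v ∷ʳ y))  ≡⟨ sym (+-suc (∣ψ∣ (v ∷ʳ y)) _) ⟩
    ∣ψ∣ (v ∷ʳ y) + suc (∣ψ∣ (v ∷ʳ y))  ≤⟨ +-monoʳ-≤ (∣ψ∣ (v ∷ʳ y))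
                                             (s≤s (∣ψ∣-run-increment [] y 1 (∣ψ∣-∷ʳ-≤ [] y) t)) ⟩
    ∣ψ∣ (v ∷ʳ y) + suc (∣ψ∣ v + 1)     ≡⟨ cong (λ n → ∣ψ∣ (v ∷ʳ y) + suc n) (+-comm (∣ψ∣ v) 1) ⟩
    ∣ψ∣ (v ∷ʳ y) + (2 + ∣ψ∣ v)         ∎
    where open ≤-Reasoning
  -- the increments of |ψ| along the final run of y's are bounded by the first one, i.e. by the claim for w
  ...   | inj₂ (w , t , refl) = ≤-of-double
    (∣ψ∣-∷ʳ-repeat-≤ w x (⊑-trans (snocRun-⊒ (w ∷ʳ x) y t) ([ y ] , refl)))
    (≤-trans (∣ψ∣-run-increment (w ∷ʳ x) y (2 + ∣ψ∣ w) (rec {w} w<v x y) t)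
             (≤-reflexive (swap (∣ψ∣ v) (∣ψ∣ w))))
    where
    w<v : length w < length v
    w<v = ≤-trans (length-<-++-∷ w x []) (⊑-length (snocRun-⊒ (w ∷ʳ x) y t))
    swap : ∀ a b → a + (2 + b) ≡ b + (2 + a)
    swap = solve-∀

module _ {A : Set} {R : A → A → Set} where

  Linked-∷ʳ-init : ∀ xs {x} → Linked R (xs ∷ʳ x) → Linked R xs
  Linked-∷ʳ-init []            _            = []
  Linked-∷ʳ-init (z ∷ [])      _            = [-]
  Linked-∷ʳ-init (z ∷ z′ ∷ xs) (Rzz′ ∷ rest) = Rzz′ ∷ Linked-∷ʳ-init (z′ ∷ xs) rest

  Linked-∷ʳ-last : ∀ xs {y x} → Linked R (xs ∷ʳ y ∷ʳ x) → R y x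
  Linked-∷ʳ-last []            (Ryx ∷ _) = Ryx
  Linked-∷ʳ-last (z ∷ [])      (_ ∷ Ryx ∷ _) = Ryx
  Linked-∷ʳ-last (z ∷ z′ ∷ xs) (_ ∷ rest) = Linked-∷ʳ-last (z′ ∷ xs) rest

  Linked-∷ʳ⁺ : ∀ xs {y x} → Linked R (xs ∷ʳ y) → R y x → Linked R (xs ∷ʳ y ∷ʳ x)
  Linked-∷ʳ⁺ []            [-]           Ryx = Ryx ∷ [-]
  Linked-∷ʳ⁺ (z ∷ [])      (Rzy ∷ [-])   Ryx = Rzy ∷ Ryx ∷ [-]
  Linked-∷ʳ⁺ (z ∷ z′ ∷ xs) (Rzz′ ∷ rest) Ryx = Rzz′ ∷ Linked-∷ʳ⁺ (z′ ∷ xs) rest Ryx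

Alternating : Word → Set
Alternating = Linked _≢_

maxLen : ℕ → ℕ
maxLen zero                = 0
maxLen (suc zero)          = 1
maxLen (suc (suc n))       = maxLen (suc n) + (2 + maxLen n)

maxLen-∷ʳ-∷ʳ : ∀ w y x → maxLen (length (w ∷ʳ y ∷ʳ x)) ≡ maxLen (length (w ∷ʳ y)) + (2 + maxLen (length w))
maxLen-∷ʳ-∷ʳ w y x rewrite length-∷ʳ (w ∷ʳ y) x | length-∷ʳ w y = refl

Fib-suc∸2≡maxLen : ∀ n → Fib (suc n) ∸ 2 ≡ maxLen n
Fib-suc∸2≡maxLen n = trans (cong (_∸ 2) (Fib-suc≡2+maxLen n)) (m+n∸m≡n 2 (maxLen n))
  where
  Fib-suc≡2+maxLen : ∀ n → Fib (suc n) ≡ 2 + maxLen n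
  Fib-suc≡2+maxLen zero          = refl
  Fib-suc≡2+maxLen (suc zero)    = refl
  Fib-suc≡2+maxLen (suc (suc n)) =
    trans (cong₂ _+_ (Fib-suc≡2+maxLen (suc n)) (Fib-suc≡2+maxLen n)) (regroup (maxLen (suc n)) (maxLen n))
    where
    regroup : ∀ p q → (2 + p) + (2 + q) ≡ 2 + (p + (2 + q))
    regroup = solve-∀

Extremal : Word → Set
Extremal v = ∣ψ∣ v ≤ maxLen (length v) × (∣ψ∣ v ≡ maxLen (length v) ⇔ Alternating v)

extremal-[_] : ∀ x → Extremal [ x ]
extremal-[ a ] = ≤-refl , mk⇔ (λ _ → [-]) (λ _ → refl)
extremal-[ b ] = ≤-refl , mk⇔ (λ _ → [-]) (λ _ → refl)

extremal-pair : ∀ y x → Extremal (y ∷ x ∷ [])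
extremal-pair a a = n≤1+n 2 , mk⇔ (λ ()) (λ { (a≢a ∷ _) → ⊥-elim (a≢a refl) })
extremal-pair a b = ≤-refl  , mk⇔ (λ _ → (λ ()) ∷ [-]) (λ _ → refl)
extremal-pair b a = ≤-refl  , mk⇔ (λ _ → (λ ()) ∷ [-]) (λ _ → refl)
extremal-pair b b = n≤1+n 2 , mk⇔ (λ ()) (λ { (b≢b ∷ _) → ⊥-elim (b≢b refl) })

∣ψ∣-alternating-≥ : ∀ w {x y} → y ≢ x →
  ∣ψ∣ (w ∷ʳ x ∷ʳ y) + ∣ψ∣ (w ∷ʳ x ∷ʳ y) ≤ ∣ψ∣ (w ∷ʳ x ∷ʳ y ∷ʳ x) + ∣ψ∣ w
∣ψ∣-alternating-≥ w {x} {y} y≢x = ∣ψ∣-∷ʳ-≥ w (∷ʳ-++ w x [ y ]) λ { (here x≡y) → y≢x (sym x≡y) }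

≥-of-double : ∀ {L c b₀ b₁} → b₁ ≡ b₀ + (2 + c) → b₁ + b₁ ≤ L + c → b₁ + (2 + b₀) ≤ L
≥-of-double {L} {c} {b₀} refl 2b₁≤L+c = +-cancelʳ-≤ c _ L (≤-trans (≤-reflexive (regroup b₀ c)) 2b₁≤L+c)
  where
  regroup : ∀ p q → (p + (2 + q)) + (2 + p) + q ≡ (p + (2 + q)) + (p + (2 + q))
  regroup = solve-∀

extremal-step : ∀ {w z y x} → Extremal w → Extremal (w ∷ʳ z) → Extremal (w ∷ʳ z ∷ʳ y) →
  Extremal (w ∷ʳ z ∷ʳ y ∷ʳ x)
extremal-step {w} {z} {y} {x} (_ , tight-w) (≤u , _) (≤uy , tight-uy) = upper , mk⇔ tight⇒alt alt⇒tight
  where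
  u v : Word
  u = w ∷ʳ z
  v = u ∷ʳ y ∷ʳ x
  B₀ B₁ : ℕ
  B₀ = maxLen (length u)
  B₁ = maxLen (length (u ∷ʳ y))
  B₂≡ : maxLen (length v) ≡ B₁ + (2 + B₀)
  B₂≡ = maxLen-∷ʳ-∷ʳ u y x
  step-bound : ∣ψ∣ (u ∷ʳ y) + (2 + ∣ψ∣ u) ≤ B₁ + (2 + B₀)
  step-bound = +-mono-≤ ≤uy (+-monoʳ-≤ 2 ≤u)
  upper : ∣ψ∣ v ≤ maxLen (length v)
  upper = ≤-trans (∣ψ∣-∷ʳ-∷ʳ-≤ u y x) (≤-trans step-bound (≤-reflexive (sym B₂≡)))
  tight⇒alt : ∣ψ∣ v ≡ maxLen (length v) → Alternating v
  tight⇒alt tight = Linked-∷ʳ⁺ u (Equivalence.to tight-uy ψuy≡B₁) y≢x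
    where
    reached : B₁ + (2 + B₀) ≤ ∣ψ∣ v
    reached = ≤-reflexive (trans (sym B₂≡) (sym tight))
    ψuy≡B₁ : ∣ψ∣ (u ∷ʳ y) ≡ B₁
    ψuy≡B₁ = ≤-antisym ≤uy (+-cancelʳ-≤ (2 + B₀) B₁ (∣ψ∣ (u ∷ʳ y))
      (≤-trans reached (≤-trans (∣ψ∣-∷ʳ-∷ʳ-≤ u y x) (+-monoʳ-≤ (∣ψ∣ (u ∷ʳ y)) (+-monoʳ-≤ 2 ≤u)))))
    y≢x : y ≢ x
    y≢x refl = <-irrefl refl (<-≤-trans (∣ψ∣-∷ʳ-∷ʳ-< u y) (≤-trans step-bound reached))
  alt⇒tight : Alternating v → ∣ψ∣ v ≡ maxLen (length v)
  alt⇒tight alt = ≤-antisym upper (≤-trans (≤-reflexive B₂≡) (≥-of-double (maxLen-∷ʳ-∷ʳ w z y) doubled))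
    where
    alt-uy : Alternating (u ∷ʳ y)
    alt-uy = Linked-∷ʳ-init (u ∷ʳ y) alt
    y≢x : y ≢ x
    y≢x = Linked-∷ʳ-last u alt
    z≡x : z ≡ x
    z≡x with ≢-cover y≢x z
    ... | inj₁ refl = ⊥-elim (Linked-∷ʳ-last w alt-uy refl)
    ... | inj₂ z≡x  = z≡x
    doubled : B₁ + B₁ ≤ ∣ψ∣ v + maxLen (length w)
    doubled = subst₂ (λ p q → p + p ≤ ∣ψ∣ v + q)
      (Equivalence.from tight-uy alt-uy)
      (Equivalence.from tight-w (Linked-∷ʳ-init w (Linked-∷ʳ-init u alt-uy)))
      (subst (λ c → ∣ψ∣ (w ∷ʳ c ∷ʳ y) + ∣ψ∣ (w ∷ʳ c ∷ʳ y) ≤ ∣ψ∣ (w ∷ʳ c ∷ʳ y ∷ʳ x) + ∣ψ∣ w)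
        (sym z≡x) (∣ψ∣-alternating-≥ w y≢x))

mutual
  extremal : ∀ {v} → Reverse v → Extremal v
  extremal []           = z≤n , mk⇔ (λ _ → []) (λ _ → refl)
  extremal (_ ∶ r ∶ʳ x) = extremal-∷ʳ₁ r x

  extremal-∷ʳ₁ : ∀ {v} → Reverse v → ∀ x → Extremal (v ∷ʳ x)
  extremal-∷ʳ₁ []           x = extremal-[ x ]
  extremal-∷ʳ₁ (_ ∶ r ∶ʳ y) x = extremal-∷ʳ₂ r y x

  extremal-∷ʳ₂ : ∀ {v} → Reverse v → ∀ y x → Extremal (v ∷ʳ y ∷ʳ x)
  extremal-∷ʳ₂ []           y x = extremal-pair y x
  extremal-∷ʳ₂ (_ ∶ r ∶ʳ z) y x = extremal-step (extremal r) (extremal-∷ʳ₁ r z) (extremal-∷ʳ₂ r z y)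

alt : ∀ n → Letter → Vec Letter n
alt zero    c = []
alt (suc n) c = c ∷ alt n (E c)

E-involutive : ∀ c → E (E c) ≡ c
E-involutive a = refl
E-involutive b = refl

letterAt : Letter → ℕ → Letter
letterAt c m = if (m % 2) ≡ᵇ 0 then c else E c

letterAt-suc : ∀ c m → letterAt c (suc m) ≡ letterAt (E c) m
letterAt-suc c zero          = refl
letterAt-suc c (suc zero)    = sym (E-involutive c)
letterAt-suc c (suc (suc m)) = begin
  letterAt c (3 + m)     ≡⟨ letterAt-2+ c (suc m) ⟩
  letterAt c (suc m)     ≡⟨ letterAt-suc c m ⟩
  letterAt (E c) m       ≡⟨ sym (letterAt-2+ (E c) m) ⟩
  letterAt (E c) (2 + m) ∎
  where
  open ≡-Reasoning
  letterAt-2+ : ∀ c m → letterAt c (2 + m) ≡ letterAt c m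
  letterAt-2+ c m = cong (λ k → if k ≡ᵇ 0 then c else E c)
    (trans (cong (_% 2) (+-comm 2 m)) ([m+n]%n≡m%n m 2))

tabulate-letterAt : ∀ n c → tabulate (λ i → letterAt c (toℕ i)) ≡ alt n c
tabulate-letterAt zero    c = refl
tabulate-letterAt (suc n) c =
  cong (c ∷_) (trans (tabulate-cong (λ i → letterAt-suc c (toℕ i))) (tabulate-letterAt n (E c)))

map-E-alt : ∀ n c → map E (alt n c) ≡ alt n (E c)
map-E-alt zero    c = refl
map-E-alt (suc n) c = cong (E c ∷_) (map-E-alt n (E c))

alt-alternating : ∀ n c → Alternating (toList (alt n c))
alt-alternating zero          c = []
alt-alternating (suc zero)    c = [-]
alt-alternating (suc (suc n)) c = E-≢ c ∷ alt-alternating (suc n) (E c)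
  where
  E-≢ : ∀ c → c ≢ E c
  E-≢ a ()
  E-≢ b ()

alternating⇒alt : ∀ {n} c (v : Vec Letter n) → Alternating (toList (c ∷ v)) → c ∷ v ≡ alt (suc n) c
alternating⇒alt c []      _              = refl
alternating⇒alt c (z ∷ v) (c≢z ∷ alt-v) with ≢⇒≡E c≢z
... | refl = cong (c ∷_) (alternating⇒alt (E c) v alt-v)

alternating⇔vAlt : ∀ {n} (v : Vec Letter n) → Alternating (toList v) ⇔ (v ≡ vAlt n ⊎ v ≡ map E (vAlt n))
alternating⇔vAlt {n} v rewrite tabulate-letterAt n a | map-E-alt n a = mk⇔ (to v) from
  where
  to : ∀ {n} (v : Vec Letter n) → Alternating (toList v) → v ≡ alt n a ⊎ v ≡ alt n b
  to []      _   = inj₁ refl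
  to (a ∷ v) alt = inj₁ (alternating⇒alt a v alt)
  to (b ∷ v) alt = inj₂ (alternating⇒alt b v alt)
  from : v ≡ alt n a ⊎ v ≡ alt n b → Alternating (toList v)
  from (inj₁ refl) = alt-alternating n a
  from (inj₂ refl) = alt-alternating n b

corollary4p3 : (n : ℕ) → (v : Vec Letter n) →
    (length (ψ (toList v)) ≤ Fib (suc n) ∸ 2)
    × ((length (ψ (toList v)) ≡ Fib (suc n) ∸ 2) ⇔ (v ≡ vAlt n ⊎ v ≡ map E (vAlt n)))
corollary4p3 n v =
  subst (∣ψ∣ (toList v) ≤_) bound≡ upper ,
  mk⇔ (λ tight → Equivalence.to (alternating⇔vAlt v) (Equivalence.to tight⇔alt (trans tight (sym bound≡))))
      (λ shape → trans (Equivalence.from tight⇔alt (Equivalence.from (alternating⇔vAlt v) shape)) bound≡)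
  where
  bound≡ : maxLen (length (toList v)) ≡ Fib (suc n) ∸ 2
  bound≡ = trans (cong maxLen (length-toList v)) (sym (Fib-suc∸2≡maxLen n))
  upper : ∣ψ∣ (toList v) ≤ maxLen (length (toList v))
  upper = proj₁ (extremal (reverseView (toList v)))
  tight⇔alt : ∣ψ∣ (toList v) ≡ maxLen (length (toList v)) ⇔ Alternating (toList v)
  tight⇔alt = proj₂ (extremal (reverseView (toList v)))
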